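{- Let $\mathfrak{F}=\langle W,R\rangle$ be an $\mathbf{S4}$ frame and $f$ a hereditary union function in $\mathfrak{F}$. Then for every $\langle w,v\rangle\in\mathrm{dom}(f)$, $f(w,v)$ strongly unites $w,v$ in $\mathfrak{F}$.
   Context: An $\mathbf{S4}$ frame is a set $W$ with a reflexive transitive relation $R$. For $X\subseteq W$: $\mathord{\uparrow}X=\{w:\exists x\in X,\ xRw\}$, $\Diamond X=\{w:\exists x\in X,\ wRx\}$, $\Box X=\{w:\forall v(wRv\Rightarrow v\in X)\}$. A point $z$ strongly unites $x_0,x_1$ if $zRx_0$, $zRx_1$, $z\in\Box(\mathord{\uparrow}\{x_0\}\cup\Diamond\mathord{\uparrow}\{x_1\})$ and $z\in\Box(\mathord{\uparrow}\{x_1\}\cup\Diamond\mathord{\uparrow}\{x_0\})$. A partial function $f:W\times W\rightharpoonup W$ is a hereditary union function in $\mathfrak{F}$ if $\mathrm{dom}(f)$ is closed under $R^\sharp$-successors (where $\langle w,v\rangle R^\sharp\langle w',v'\rangle$ iff $wRw'$ and $vRv'$), and for every $\langle w,v\rangle\in\mathrm{dom}(f)$: $f(w,v)Rw$, $f(w,v)Rv$, and for every $t$ with $f(w,v)Rt$, either $wRt$, or $vRt$, or there are $w',v'$ with $wRw'$, $vRv'$ and $t=f(w',v')$. -}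

module Defs where

open import Level using (Level; _⊔_; suc)
open import Data.Product using (Σ; ∃; _×_; _,_)
open import Data.Sum using (_⊎_)
open import Relation.Binary.PropositionalEquality using (_≡_)
open import Relation.Binary.Core using (Rel)
open import Relation.Binary.Definitions using (Reflexive; Transitive)

record S4Frame (a r : Level) : Set (suc (a ⊔ r)) where
  field
    W     : Set a
    R     : Rel W r
    refl  : Reflexive R
    trans : Transitive R

module _ {a r : Level} (𝔉 : S4Frame a r) where
  open S4Frame 𝔉

  Subset : (p : Level) → Set (a ⊔ suc p)
  Subset p = W → Set p

  ↑ : ∀ {p} → Subset p → Subset (a ⊔ r ⊔ p)
  ↑ X w = ∃ λ x → X x × R x w

  ◇ : ∀ {p} → Subset p → Subset (a ⊔ r ⊔ p)
  ◇ X w = ∃ λ x → X x × R w x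

  □ : ∀ {p} → Subset p → Subset (a ⊔ r ⊔ p)
  □ X w = ∀ v → R w v → X v

  ｛_｝ : W → Subset a
  ｛ x ｝ y = x ≡ y

  _∪_ : ∀ {p q} → Subset p → Subset q → Subset (p ⊔ q)
  (X ∪ Y) w = X w ⊎ Y w

  StronglyUnites : W → W → W → Set (a ⊔ r)
  StronglyUnites z x₀ x₁ =
    R z x₀ × R z x₁ ×
    □ (↑ ｛ x₀ ｝ ∪ ◇ (↑ ｛ x₁ ｝)) z ×
    □ (↑ ｛ x₁ ｝ ∪ ◇ (↑ ｛ x₀ ｝)) z

  -- A partial function f : W × W ⇀ W, given by its domain (a predicate on
  -- W × W) and a value for each element of the domain; the value does not
  -- depend on the membership proof.
  record PartialFun (d : Level) : Set (a ⊔ suc d) where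
    field
      dom   : W → W → Set d
      app   : (w v : W) → dom w v → W
      app-irr : ∀ {w v} (p q : dom w v) → app w v p ≡ app w v q

  record IsHereditaryUnionFunction {d : Level} (f : PartialFun d) : Set (a ⊔ r ⊔ d) where
    open PartialFun f
    field
      dom-closed : ∀ {w v w′ v′} → dom w v → R w w′ → R v v′ → dom w′ v′
      f-R-left   : ∀ {w v} (p : dom w v) → R (app w v p) w
      f-R-right  : ∀ {w v} (p : dom w v) → R (app w v p) v
      f-succ     : ∀ {w v} (p : dom w v) (t : W) → R (app w v p) t →
                   R w t ⊎ R v t ⊎
                   (Σ W λ w′ → Σ W λ v′ → R w w′ × R v v′ ×
                     Σ (dom w′ v′) λ p′ → t ≡ app w′ v′ p′)

{-# OPTIONS --safe #-}
module Submission where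

open import Defs
open import Level using (Level; _⊔_)
open import Data.Product using (_×_; _,_; swap)
open import Data.Sum using (_⊎_; inj₁; inj₂)
open import Relation.Binary.PropositionalEquality using (refl)

module _ {a r : Level} (𝔉 : S4Frame a r) where
  open S4Frame 𝔉 renaming (refl to R-refl)

  ↑｛_｝ : W → Subset 𝔉 (a ⊔ r)
  ↑｛ x ｝ = ↑ 𝔉 (｛_｝ 𝔉 x)

  R⇒↑｛｝ : ∀ {x t} → R x t → ↑｛ x ｝ t
  R⇒↑｛｝ xRt = _ , refl , xRt

  ⊆◇ : ∀ {p} {X : Subset 𝔉 p} {t} → X t → ◇ 𝔉 X t
  ⊆◇ Xt = _ , Xt , R-refl

  UnionSuccessor : W → W → W → Set (a ⊔ r)
  UnionSuccessor x₀ x₁ t =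
    R x₀ t ⊎ R x₁ t ⊎ (◇ 𝔉 ↑｛ x₀ ｝ t × ◇ 𝔉 ↑｛ x₁ ｝ t)

  UnionSuccessor-sym : ∀ {x₀ x₁ t} → UnionSuccessor x₀ x₁ t → UnionSuccessor x₁ x₀ t
  UnionSuccessor-sym (inj₁ x₀Rt)        = inj₂ (inj₁ x₀Rt)
  UnionSuccessor-sym (inj₂ (inj₁ x₁Rt)) = inj₁ x₁Rt
  UnionSuccessor-sym (inj₂ (inj₂ both)) = inj₂ (inj₂ (swap both))

  UnionSuccessor⇒↑∪◇↑ : ∀ {x₀ x₁ t} → UnionSuccessor x₀ x₁ t →
                        _∪_ 𝔉 ↑｛ x₀ ｝ (◇ 𝔉 ↑｛ x₁ ｝) t
  UnionSuccessor⇒↑∪◇↑ (inj₁ x₀Rt)              = inj₁ (R⇒↑｛｝ x₀Rt)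
  UnionSuccessor⇒↑∪◇↑ (inj₂ (inj₁ x₁Rt))       = inj₂ (⊆◇ (R⇒↑｛｝ x₁Rt))
  UnionSuccessor⇒↑∪◇↑ (inj₂ (inj₂ (_ , ◇x₁))) = inj₂ ◇x₁

  □UnionSuccessor⇒StronglyUnites : ∀ {z x₀ x₁} → R z x₀ → R z x₁ →
                                   □ 𝔉 (UnionSuccessor x₀ x₁) z →
                                   StronglyUnites 𝔉 z x₀ x₁
  □UnionSuccessor⇒StronglyUnites zRx₀ zRx₁ □succ =
      zRx₀
    , zRx₁
    , (λ t zRt → UnionSuccessor⇒↑∪◇↑ (□succ t zRt))
    , (λ t zRt → UnionSuccessor⇒↑∪◇↑ (UnionSuccessor-sym (□succ t zRt)))

module _ {a r d : Level} {𝔉 : S4Frame a r} {f : PartialFun 𝔉 d}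
         (H : IsHereditaryUnionFunction 𝔉 f) where
  open S4Frame 𝔉
  open PartialFun f
  open IsHereditaryUnionFunction H

  -- A successor f(w′, v′) of f(w, v) sees w′ ∈ ↑{w} and v′ ∈ ↑{v}.
  app-successor : ∀ {w v} (p : dom w v) →
                  □ 𝔉 (UnionSuccessor 𝔉 w v) (app w v p)
  app-successor p t zRt with f-succ p t zRt
  ... | inj₁ wRt        = inj₁ wRt
  ... | inj₂ (inj₁ vRt) = inj₂ (inj₁ vRt)
  ... | inj₂ (inj₂ (w′ , v′ , wRw′ , vRv′ , p′ , refl)) =
    inj₂ (inj₂ ( (w′ , R⇒↑｛｝ 𝔉 wRw′ , f-R-left p′)
               , (v′ , R⇒↑｛｝ 𝔉 vRv′ , f-R-right p′)))

lemma15 : {a r d : Level} (𝔉 : S4Frame a r) (f : PartialFun 𝔉 d) →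
          IsHereditaryUnionFunction 𝔉 f →
          ∀ w v (p : PartialFun.dom f w v) →
          StronglyUnites 𝔉 (PartialFun.app f w v p) w v
lemma15 𝔉 f H w v p =
  □UnionSuccessor⇒StronglyUnites 𝔉 (f-R-left p) (f-R-right p) (app-successor H p)
  where open IsHereditaryUnionFunction H
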